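{- If $\mathcal{H}\subseteq\mathrm{bb}^\infty(E)$ is a family for which every clopen subset of $\mathrm{bb}^\infty(E)$ is $\mathcal{H}$-strategically Ramsey, then $\mathcal{H}$ is full.
   Context: Let $F$ be a countable field and $E$ a countably infinite-dimensional $F$-vector space with Hamel basis $(e_n)$. For nonzero $v=\sum a_ne_n$, $\mathrm{supp}(v)=\{n:a_n\neq0\}$; $n<v$ means $n<\min\mathrm{supp}(v)$, $v<w$ means $\max\mathrm{supp}(v)<\min\mathrm{supp}(w)$. Block sequences: sequences of nonzero vectors with $x_n<x_{n+1}$; $\mathrm{bb}^\infty(E)$ the infinite ones (subspace of $E^{\mathbb{N}}$ with $E$ discrete), $\mathrm{bb}^{<\infty}(E)$ the finite ones. $\langle X\rangle$ is the span minus $\{0\}$; $X\preceq Y$ iff $\langle X\rangle\subseteq\langle Y\rangle$; $X/m$ is the tail with supports above $m$; $X\preceq^*Y$ iff $X/m\preceq Y$ for some $m$. A family is a nonempty subset of $\mathrm{bb}^\infty(E)$ closed upward under $\preceq^*$; $\mathcal{H}\upharpoonright X=\{Y\in\mathcal{H}:Y\preceq X\}$. $D\subseteq E$ is $\mathcal{H}$-dense below $X\in\mathcal{H}$ if every $Y\in\mathcal{H}\upharpoonright X$ has some $Z\preceq Y$ with $\langle Z\rangle\subseteq D$; $\mathcal{H}$ is full if for every such $D$ and $X$ there is $Z\in\mathcal{H}\upharpoonright X$ with $\langle Z\rangle\subseteq D$. Games for $\vec{y}\in\mathrm{bb}^{<\infty}(E)$, $Y\in\mathrm{bb}^\infty(E)$: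 in $G[\vec{y},Y]$, I plays $Y_k\preceq Y$ and II responds with $z_k\in\langle Y_k\rangle$, with $\vec{y}<z_0<z_1<\cdots$ (i.e. above the supports of $\vec y$); in $F[\vec{y},Y]$, I plays $n_k\in\mathbb{N}$ and II responds with $z_k\in\langle Y/n_k\rangle$, with $\vec y<z_0<z_1<\cdots$; in both the outcome is $\vec{y}^\frown(z_k)$. A set $\mathbb{A}\subseteq\mathrm{bb}^\infty(E)$ is $\mathcal{H}$-strategically Ramsey if for all $\vec{y}\in\mathrm{bb}^{<\infty}(E)$ and $X\in\mathcal{H}$ there is $Y\in\mathcal{H}\upharpoonright X$ such that either I has a strategy in $F[\vec{y},Y]$ all of whose outcomes lie in $\mathbb{A}^c$, or II has a strategy in $G[\vec{y},Y]$ all of whose outcomes lie in $\mathbb{A}$. -}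

module Defs where

open import Level using (0ℓ)
open import Algebra.Bundles using (CommutativeRing)
open import Data.Nat using (ℕ; zero; suc; _<_; _≤_) renaming (_+_ to _+ℕ_)
open import Data.Fin using (Fin) renaming (zero to fzero; suc to fsuc)
open import Data.List using (List; []; _∷_; applyUpTo; length)
open import Data.List.Relation.Unary.All using (All)
open import Data.Product using (Σ; ∃; _×_; _,_)
open import Data.Sum using (_⊎_)
open import Relation.Nullary using (¬_)

record Field : Set₁ where
  field
    commutativeRing : CommutativeRing 0ℓ 0ℓ
  open CommutativeRing commutativeRing public
  field
    1≉0     : ¬ (1# ≈ 0#)
    inverse : ∀ x → ¬ (x ≈ 0#) → ∃ λ y → (x * y) ≈ 1#

-- A countable field: there is a surjection ℕ → F (a field is nonempty,
-- so this is "finite or countably infinite").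
Countable : Field → Set
Countable F = Σ (ℕ → Carrier) λ f → ∀ x → ∃ λ n → f n ≈ x
  where open Field F

module Over (F : Field) where
  open Field F

  -- E: the F-vector space with Hamel basis (e_n); a vector Σ a_n e_n is
  -- given by its (finitely supported) coefficient sequence.
  record Vec : Set where
    constructor vec
    field
      coeff : ℕ → Carrier
      bound : ℕ
      finite : ∀ n → bound ≤ n → coeff n ≈ 0#
  open Vec public

  _≈ᵥ_ : Vec → Vec → Set
  v ≈ᵥ w = ∀ n → coeff v n ≈ coeff w n

  _∈supp_ : ℕ → Vec → Set
  n ∈supp v = ¬ (coeff v n ≈ 0#)

  NonZero : Vec → Set
  NonZero v = ∃ λ n → n ∈supp v

  _<ᵛ_ : ℕ → Vec → Set
  n <ᵛ v = ∀ j → j ∈supp v → n < j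

  _≺_ : Vec → Vec → Set
  v ≺ w = ∀ i j → i ∈supp v → j ∈supp w → i < j

  Seq : Set
  Seq = ℕ → Vec

  IsBlock : Seq → Set
  IsBlock X = (∀ n → NonZero (X n)) × (∀ n → X n ≺ X (suc n))

  data IsFinBlock : List Vec → Set where
    []  : IsFinBlock []
    _∷_ : ∀ {v vs} → NonZero v × All (v ≺_) vs → IsFinBlock vs →
          IsFinBlock (v ∷ vs)

  _≺*_ : List Vec → Vec → Set
  ys ≺* z = All (_≺ z) ys

  lincomb : (n : ℕ) → (Fin n → Carrier) → Seq → ℕ → Carrier
  lincomb zero    c X i = 0#
  lincomb (suc n) c X i =
    (c fzero * coeff (X 0) i) + lincomb n (λ k → c (fsuc k)) (λ k → X (suc k)) i

  _∈⟨_⟩ : Vec → Seq → Set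
  v ∈⟨ X ⟩ = NonZero v ×
    ∃ λ n → Σ (Fin n → Carrier) λ c → ∀ i → coeff v i ≈ lincomb n c X i

  shift : ℕ → Seq → Seq
  shift k X i = X (k +ℕ i)

  -- X/m is the tail (x_k, x_{k+1}, …) of X starting at the
  -- least k with m < x_k; since larger k give smaller spans, the span of
  -- X/m is the union of the spans of all tails shift k X with m < x_k.
  _∈⟨_/_⟩ : Vec → Seq → ℕ → Set
  v ∈⟨ X / m ⟩ = ∃ λ k → (m <ᵛ X k) × v ∈⟨ shift k X ⟩

  _⪯_ : Seq → Seq → Set
  X ⪯ Y = ∀ v → v ∈⟨ X ⟩ → v ∈⟨ Y ⟩

  _⪯*_ : Seq → Seq → Set
  X ⪯* Y = ∃ λ m → ∀ v → v ∈⟨ X / m ⟩ → v ∈⟨ Y ⟩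

  IsFamily : (Seq → Set) → Set
  IsFamily H =
    (∃ λ X → H X) ×
    (∀ X → H X → IsBlock X) ×
    (∀ X Y → H X → IsBlock Y → X ⪯* Y → H Y)

  DenseBelow : (Seq → Set) → (Vec → Set) → Seq → Set
  DenseBelow H D X =
    ∀ Y → H Y → Y ⪯ X →
      ∃ λ Z → IsBlock Z × Z ⪯ Y × (∀ v → v ∈⟨ Z ⟩ → D v)

  Full : (Seq → Set) → Set₁
  Full H =
    ∀ (D : Vec → Set) X → H X → DenseBelow H D X →
      ∃ λ Z → H Z × Z ⪯ X × (∀ v → v ∈⟨ Z ⟩ → D v)

  -- Topology on bb^∞(E) ⊆ E^ℕ (E discrete): basic neighbourhoods are given
  -- by fixing finitely many initial terms.

  Agree : ℕ → Seq → Seq → Set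
  Agree n X X' = ∀ i → i < n → X i ≈ᵥ X' i

  IsOpen : (Seq → Set) → Set
  IsOpen A = ∀ X → IsBlock X → A X →
    ∃ λ n → ∀ X' → IsBlock X' → Agree n X X' → A X'

  IsClopenSubset : (Seq → Set) → Set
  IsClopenSubset A =
    (∀ X → A X → IsBlock X) × IsOpen A × IsOpen (λ X → ¬ A X)

  _⌢_ : List Vec → Seq → Seq
  ([]     ⌢ z) n       = z n
  ((y ∷ ys) ⌢ z) zero    = y
  ((y ∷ ys) ⌢ z) (suc n) = (ys ⌢ z) n

  prefix : {A : Set} → (ℕ → A) → ℕ → List A
  prefix f k = applyUpTo f k

  -- Game F[~y, Y]: a strategy for I maps II's previous moves (z_0,…,z_{k-1})
  -- to I's next move n_k.
  IWinsF : List Vec → Seq → (Seq → Set) → Set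
  IWinsF ys Y P =
    ∃ λ (σ : List Vec → ℕ) →
      ∀ (z : Seq) →
        (∀ k → z k ∈⟨ Y / σ (prefix z k) ⟩) →
        ys ≺* z 0 →
        (∀ k → z k ≺ z (suc k)) →
        P (ys ⌢ z)

  -- Game G[~y, Y]: a strategy for II maps I's moves (Y_0,…,Y_k) to II's
  -- answer z_k.
  IIWinsG : List Vec → Seq → (Seq → Set) → Set
  IIWinsG ys Y P =
    ∃ λ (τ : List Seq → Vec) →
      ∀ (Ys : ℕ → Seq) →
        (∀ k → IsBlock (Ys k) × Ys k ⪯ Y) →
        let z = λ k → τ (prefix Ys (suc k)) in
        (∀ k → z k ∈⟨ Ys k ⟩) ×
        ys ≺* z 0 ×
        (∀ k → z k ≺ z (suc k)) ×
        P (ys ⌢ z)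

  StrategicallyRamsey : (Seq → Set) → (Seq → Set) → Set
  StrategicallyRamsey H A =
    ∀ ys → IsFinBlock ys → ∀ X → H X →
      ∃ λ Y → H Y × Y ⪯ X ×
        (IWinsF ys Y (λ W → ¬ A W) ⊎ IIWinsG ys Y A)

-- Apply the Ramsey property to the clopen set A of block sequences whose
-- first term lies outside D.  II cannot win G[∅, Y] into A: by density, I
-- can play a Z ⪯ Y with ⟨Z⟩ ⊆ D throughout, and II's first answer then lies
-- in D.  So I wins F[∅, Y] out of A with some first move n₀; since II may
-- open with any vector of ⟨Y/n₀⟩, every such vector lies in D, and the tail
-- of Y beyond n₀ is the required member of H below X.
-- Constructively, the last step needs ¬¬ D v → D v; this comes from the
-- same hypothesis, since the Ramsey dichotomy for the constant clopen set
-- {W : P} decides P.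
module Submission where

open import Defs
open import Data.Product using (_×_; ∃; _,_; proj₁; proj₂)
open import Data.Sum using (_⊎_; inj₁; inj₂)
open import Data.Empty using (⊥-elim)
open import Data.Nat using (ℕ; zero; suc; _<_; _≤_; _≤′_; _<′_; ≤′-refl; ≤′-step; z≤n; s≤s; _≤?_)
  renaming (_+_ to _+ℕ_)
open import Data.Nat.Properties
  using (≰⇒>; ≤-trans; ≤-<-trans; <-≤-trans; <-asym; ≤⇒≤′; z≤′n; n<1+n; m≤m+n; m≤n+m; +-suc; +-identityʳ)
open import Data.Fin using (Fin) renaming (zero to fzero; suc to fsuc)
open import Data.List using (List; []; _∷ʳ_)
open import Data.List.Properties using (applyUpTo-∷ʳ)
open import Data.List.Relation.Unary.All using ([])
open import Function using (case_of_)
open import Relation.Nullary using (¬_; yes; no)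
open import Relation.Binary.Definitions using (_Respects_)
open import Relation.Binary.PropositionalEquality using (_≡_; refl; sym; trans; cong; cong₂; subst)

module BlockSequences (F : Field) where
  open Over F
  module R = Field F

  supp<bound : ∀ v {i} → i ∈supp v → i < bound v
  supp<bound v {i} i∈v with bound v ≤? i
  ... | yes b≤i = ⊥-elim (i∈v (finite v i b≤i))
  ... | no  b≰i = ≰⇒> b≰i

  block-index≤supp : ∀ Y → IsBlock Y → ∀ j {i} → i ∈supp Y j → j ≤ i
  block-index≤supp Y bY zero    _       = z≤n
  block-index≤supp Y bY (suc j) i∈Yj+1 with proj₁ bY j
  ... | p , p∈Yj = ≤-<-trans (block-index≤supp Y bY j p∈Yj) (proj₂ bY j _ _ p∈Yj i∈Yj+1)

  shift-isBlock : ∀ Y → IsBlock Y → ∀ k → IsBlock (shift k Y)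
  shift-isBlock Y (nonzero , ordered) k =
    (λ n → nonzero (k +ℕ n)) ,
    λ n → subst (λ t → Y (k +ℕ n) ≺ Y t) (sym (+-suc k n)) (ordered (k +ℕ n))

  ∈⟨⟩-resp-≈ᵥ : ∀ {X v w} → w ≈ᵥ v → v ∈⟨ X ⟩ → w ∈⟨ X ⟩
  ∈⟨⟩-resp-≈ᵥ w≈v ((n , n∈v) , k , c , v≈) =
    (n , λ w≈0 → n∈v (R.trans (R.sym (w≈v n)) w≈0)) , k , c , λ i → R.trans (w≈v i) (v≈ i)

  lincomb-cong : ∀ {X X'} → (∀ t → X t ≡ X' t) → ∀ n c i → lincomb n c X i ≡ lincomb n c X' i
  lincomb-cong X≡X' zero    c i = refl
  lincomb-cong X≡X' (suc n) c i =
    cong₂ R._+_ (cong (λ w → c fzero R.* coeff w i) (X≡X' 0))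
                (lincomb-cong (λ t → X≡X' (suc t)) n (λ k → c (fsuc k)) i)

  ⪯-of-≡ : ∀ {X X'} → (∀ t → X t ≡ X' t) → X ⪯ X'
  ⪯-of-≡ X≡X' _ (nz , n , c , v≈) =
    nz , n , c , λ i → R.trans (v≈ i) (R.reflexive (lincomb-cong X≡X' n c i))

  head∈⟨⟩ : ∀ X → NonZero (X 0) → X 0 ∈⟨ X ⟩
  head∈⟨⟩ X nz = nz , 1 , (λ _ → R.1#) , λ i → R.sym (R.trans (R.+-identityʳ _) (R.*-identityˡ _))

  tail⪯ : ∀ X → (λ t → X (suc t)) ⪯ X
  tail⪯ X v (nz , n , c , v≈) =
    nz , suc n , c₀ , λ i → R.trans (v≈ i) (R.sym (R.trans (R.+-congʳ (R.zeroˡ _)) (R.+-identityˡ _)))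
    where
      c₀ : Fin (suc n) → R.Carrier
      c₀ fzero    = R.0#
      c₀ (fsuc k) = c k

  shift-antitone : ∀ Y {k k'} → k ≤′ k' → shift k' Y ⪯ shift k Y
  shift-antitone Y ≤′-refl v v∈ = v∈
  shift-antitone Y (≤′-step {k'} k≤k') v v∈ =
    shift-antitone Y k≤k' v (tail⪯ (shift k' Y) v (⪯-of-≡ (λ t → cong Y (sym (+-suc k' t))) v v∈))

  term∈⟨/⟩ : ∀ Y {m j} → IsBlock Y → m < j → Y j ∈⟨ Y / m ⟩
  term∈⟨/⟩ Y {j = j} bY m<j =
    j , (λ i i∈Yj → <-≤-trans m<j (block-index≤supp Y bY j i∈Yj)) ,
    subst (λ t → Y t ∈⟨ shift j Y ⟩) (+-identityʳ j) (head∈⟨⟩ (shift j Y) (proj₁ bY (j +ℕ 0)))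

  shift-suc⪯/ : ∀ Y → IsBlock Y → ∀ n v → v ∈⟨ shift (suc n) Y ⟩ → v ∈⟨ Y / n ⟩
  shift-suc⪯/ Y bY n v v∈ = suc n , (λ i i∈ → block-index≤supp Y bY (suc n) i∈) , v∈

  boundOfFirst : Seq → ℕ → ℕ
  boundOfFirst Y zero    = 0
  boundOfFirst Y (suc k) = boundOfFirst Y k +ℕ bound (Y k)

  bound≤boundOfFirst : ∀ Y {j k} → j <′ k → bound (Y j) ≤ boundOfFirst Y k
  bound≤boundOfFirst Y ≤′-refl          = m≤n+m _ _
  bound≤boundOfFirst Y (≤′-step j<′k) = ≤-trans (bound≤boundOfFirst Y j<′k) (m≤m+n _ _)

  ⪯*-shift : ∀ Y → (∀ n → NonZero (Y n)) → ∀ k → Y ⪯* shift k Y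
  ⪯*-shift Y nonzero k =
    boundOfFirst Y k , λ { v (k' , above , v∈) → shift-antitone Y (≤⇒≤′ (k≤k' k' above)) v v∈ }
    where
      k≤k' : ∀ k' → boundOfFirst Y k <ᵛ Y k' → k ≤ k'
      k≤k' k' above with k ≤? k' | nonzero k'
      ... | yes k≤k' | _      = k≤k'
      ... | no  k≰k' | q , q∈ =
        ⊥-elim (<-asym (above q q∈)
          (<-≤-trans (supp<bound (Y k') q∈) (bound≤boundOfFirst Y (≤⇒≤′ (≰⇒> k≰k')))))

  -- II opens with v; afterwards II answers I's move n with a term of Y
  -- indexed above both n and the support of the previous answer.
  module OpeningPlay (Y : Seq) (bY : IsBlock Y) (σ : List Vec → ℕ) (v : Vec) where
    next : List Vec × Vec → List Vec × Vec
    next (history , z) = history ∷ʳ z , Y (suc (σ (history ∷ʳ z)) +ℕ bound z)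

    position : ℕ → List Vec × Vec
    position zero    = [] , v
    position (suc k) = next (position k)

    play : Seq
    play k = proj₂ (position k)

    prefix-play : ∀ k → prefix play k ≡ proj₁ (position k)
    prefix-play zero    = refl
    prefix-play (suc k) = trans (sym (applyUpTo-∷ʳ play k)) (cong (_∷ʳ play k) (prefix-play k))

    play-legal : v ∈⟨ Y / σ [] ⟩ → ∀ k → play k ∈⟨ Y / σ (prefix play k) ⟩
    play-legal v∈ zero    = v∈
    play-legal v∈ (suc k) =
      subst (λ h → play (suc k) ∈⟨ Y / σ h ⟩) (sym (prefix-play (suc k)))
            (term∈⟨/⟩ Y bY (s≤s (m≤m+n _ _)))

    play-ordered : ∀ k → play k ≺ play (suc k)
    play-ordered k i j i∈ j∈ =
      <-≤-trans (supp<bound (play k) i∈) (≤-trans (m≤n+m _ _) (block-index≤supp Y bY _ j∈))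

    play-isBlock : NonZero v → IsBlock play
    play-isBlock nz = nonzero , play-ordered
      where
        nonzero : ∀ k → NonZero (play k)
        nonzero zero    = nz
        nonzero (suc k) = proj₁ bY _

  IWinsF⇒openings : ∀ Y P → IsBlock Y → IWinsF [] Y P →
    ∃ λ n → ∀ v → v ∈⟨ Y / n ⟩ → ∃ λ W → IsBlock W × W 0 ≡ v × P W
  IWinsF⇒openings Y P bY (σ , wins) = σ [] , λ v v∈ →
    let open OpeningPlay Y bY σ v in
    play , play-isBlock (proj₁ (proj₂ (proj₂ v∈))) , refl , wins play (play-legal v∈) [] play-ordered

  IIWinsG⇒answer : ∀ Y Z P → IIWinsG [] Y P → IsBlock Z → Z ⪯ Y → ∃ λ W → W 0 ∈⟨ Z ⟩ × P W
  IIWinsG⇒answer Y Z P (τ , wins) bZ Z⪯Y =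
    let legal , _ , _ , outcome = wins (λ _ → Z) (λ _ → bZ , Z⪯Y) in _ , legal 0 , outcome

  constant-isClopen : (P : Set) → IsClopenSubset (λ W → IsBlock W × P)
  constant-isClopen P =
    (λ _ → proj₁) ,
    (λ _ _ (_ , p) → 0 , λ _ bW' _ → bW' , p) ,
    (λ _ bW ¬a → 0 , λ _ _ _ (_ , p) → ¬a (bW , p))

  Ramsey⇒excludedMiddle : ∀ {H} → IsFamily H →
    (∀ A → IsClopenSubset A → StrategicallyRamsey H A) → (P : Set) → P ⊎ ¬ P
  Ramsey⇒excludedMiddle ((X , hX) , isBlock , _) ramsey P
    with ramsey (λ W → IsBlock W × P) (constant-isClopen P) [] [] X hX
  ... | Y , hY , _ , inj₂ IIwins =
    let _ , _ , _ , p = IIWinsG⇒answer Y Y (λ W → IsBlock W × P) IIwins (isBlock Y hY) (λ _ v∈ → v∈)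
    in inj₁ p
  ... | Y , hY , _ , inj₁ Iwins =
    let n , openings = IWinsF⇒openings Y (λ W → ¬ (IsBlock W × P)) (isBlock Y hY) Iwins
        W , bW , _ , ¬a = openings (Y (suc n)) (term∈⟨/⟩ Y (isBlock Y hY) (n<1+n n))
    in inj₂ λ p → ¬a (bW , p)

  -- D itself need not respect ≈ᵥ, but a set of sequences defined from it must,
  -- to be open for the topology given by Agree.
  ≈ᵥ-core : (Vec → Set) → Vec → Set
  ≈ᵥ-core D v = ∀ w → w ≈ᵥ v → D w

  ≈ᵥ-core-resp : ∀ D → ≈ᵥ-core D Respects _≈ᵥ_
  ≈ᵥ-core-resp D v≈v' core w w≈v' = core w (λ n → R.trans (w≈v' n) (R.sym (v≈v' n)))

  HeadOutside : (Vec → Set) → Seq → Set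
  HeadOutside C W = IsBlock W × ¬ C (W 0)

  headOutside-isClopen : ∀ C → C Respects _≈ᵥ_ → IsClopenSubset (HeadOutside C)
  headOutside-isClopen C resp =
    (λ _ → proj₁) ,
    (λ _ _ (_ , ∉C) → 1 , λ _ bW' agree → bW' , λ ∈C → ∉C (resp (λ i → R.sym (agree 0 (s≤s z≤n) i)) ∈C)) ,
    (λ _ bW ¬a → 1 , λ _ _ agree (_ , ∉C) → ¬a (bW , λ ∈C → ∉C (resp (agree 0 (s≤s z≤n)) ∈C)))

  dense⇒¬IIWinsG : ∀ {H D X Y} → DenseBelow H D X → H Y → Y ⪯ X →
    ¬ IIWinsG [] Y (HeadOutside (≈ᵥ-core D))
  dense⇒¬IIWinsG {D = D} {Y = Y} dense hY Y⪯X IIwins =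
    let Z , bZ , Z⪯Y , Z⊆D = dense Y hY Y⪯X
        W , W₀∈Z , _ , W₀∉core = IIWinsG⇒answer Y Z (HeadOutside (≈ᵥ-core D)) IIwins bZ Z⪯Y
    in W₀∉core λ u u≈W₀ → Z⊆D u (∈⟨⟩-resp-≈ᵥ {Z} {W 0} {u} u≈W₀ W₀∈Z)

  IWinsF⇒span⊆ : ∀ Y C → (∀ P → P ⊎ ¬ P) → IsBlock Y →
    IWinsF [] Y (λ W → ¬ HeadOutside C W) → ∃ λ n → ∀ v → v ∈⟨ Y / n ⟩ → C v
  IWinsF⇒span⊆ Y C excludedMiddle bY Iwins =
    let n , openings = IWinsF⇒openings Y (λ W → ¬ HeadOutside C W) bY Iwins
    in n , λ v v∈ → stable v (openings v v∈)
    where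
      stable : ∀ v → (∃ λ W → IsBlock W × W 0 ≡ v × ¬ HeadOutside C W) → C v
      stable v (W , bW , refl , ¬a) with excludedMiddle (C (W 0))
      ... | inj₁ ∈C = ∈C
      ... | inj₂ ∉C = ⊥-elim (¬a (bW , ∉C))

proposition3p6 : (F : Field) → Countable F →
    let open Over F in
    (H : Seq → Set) → IsFamily H →
    (∀ (A : Seq → Set) → IsClopenSubset A → StrategicallyRamsey H A) →
    Full H
proposition3p6 F _ H family@(_ , isBlock , upward) ramsey D X hX dense =
  case ramsey A A-isClopen [] [] X hX of λ where
    (Y , hY , Y⪯X , inj₂ IIwins) → ⊥-elim (dense⇒¬IIWinsG dense hY Y⪯X IIwins)
    (Y , hY , Y⪯X , inj₁ Iwins) →
      let bY = isBlock Y hY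
          n , tail⊆core = IWinsF⇒span⊆ Y (≈ᵥ-core D) (Ramsey⇒excludedMiddle family ramsey) bY Iwins
          Z = shift (suc n) Y
      in Z , upward Y Z hY (shift-isBlock Y bY (suc n)) (⪯*-shift Y (proj₁ bY) (suc n)) ,
         (λ v v∈Z → Y⪯X v (shift-antitone Y z≤′n v v∈Z)) ,
         λ v v∈Z → tail⊆core v (shift-suc⪯/ Y bY n v v∈Z) v (λ _ → R.refl)
  where
    open Over F
    open BlockSequences F

    A : Seq → Set
    A = HeadOutside (≈ᵥ-core D)

    A-isClopen : IsClopenSubset A
    A-isClopen = headOutside-isClopen (≈ᵥ-core D) λ {v} {v'} → ≈ᵥ-core-resp D {v} {v'}
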